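{- Let $r\geq 5$, $s=\lceil r/2\rceil$ and $h\geq\binom{r}{2}$. If $\ell$ and $i$ are integers satisfying either (i) $2\leq\ell\leq s-2$ and $r-s+1\leq i\leq r-1$, or (ii) $\ell=s-1$ and $r-s+2\leq i\leq r-1$, then $$\frac{2}{r}\left(r-2-\frac{\ell-1}{i-\ell}\right)\left(h-\frac{r(r-2)}{4}+1\right)\geq h-\big((\ell-1)s+r-i\big).$$ -}

module Defs where

open import Data.Nat as ℕ using (ℕ; _/_)
open import Data.Integer using (+_)
open import Data.Rational as ℚ using (ℚ; 0ℚ; _÷_; _≟_; ≢-nonZero)
open import Relation.Nullary using (yes; no)

⟦_⟧ : ℕ → ℚ
⟦ n ⟧ = + n ℚ./ 1

-- total division on ℚ: p ⊘ q = p / q for q ≠ 0 (value 0 when q = 0;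
-- this case never arises in the statement below, where all denominators are nonzero)
_⊘_ : ℚ → ℚ → ℚ
p ⊘ q with q ≟ 0ℚ
... | yes _ = 0ℚ
... | no q≢0 = _÷_ p q {{≢-nonZero q≢0}}

infixl 7 _⊘_

⌈_/2⌉ : ℕ → ℕ
⌈ r /2⌉ = ℕ.suc r / 2

-- Write a = ℓ − 1, d = i − ℓ and e = r − i, so that r = 1 + a + d + e. Both ranges of (ℓ, i) force
-- a ≥ 1, d ≥ 2 and e ≥ 1, and together with r ≤ 2s and h ≥ C(r,2) this is all the inequality needs.
-- Multiplying by 4rd clears the denominators and leaves an inequality between polynomials with natural
-- coefficients, linear in h and s. Since d(r − 4) ≥ 2a, its right side grows faster in h (and in s)
-- than its left side, so it suffices to check it at 2h = r(r − 1) and 2s = r; there, after the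
-- substitution a = 1 + A, d = 2 + D, e = 1 + E, the difference of the two sides has only nonnegative
-- coefficients.
{-# OPTIONS --safe #-}
module Submission where

open import Defs
open import Data.Nat using (ℕ; zero; suc; _∸_; _≤_; _<_; s≤s; z≤n; NonZero; ≢-nonZero⁻¹)
import Data.Nat.Properties as ℕ
open import Data.Product using (_×_; _,_; ∃-syntax)
open import Data.Sum using (_⊎_; inj₁; inj₂)
open import Relation.Binary.PropositionalEquality

-- Natural-number arithmetic gets its own scope, so that _+_ and _*_ can denote ℚ operations below.
module _ where
  open import Data.Nat using (_+_; _*_)
  open import Data.Nat.Properties
    using (m≤n⇒∃[o]m+o≡n; m+n∸m≡n; m≤m+n; +-cancelʳ-≡; +-suc; +-comm; +-identityʳ; *-distribˡ-+; *-monoʳ-≤;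
           ≤-trans; +-monoʳ-≤; *-cancelˡ-<; m+[n∸m]≡n; m≤o∸n⇒m+n≤o; m+n≤o⇒m≤o∸n; m≤n+o⇒m∸n≤o; m≤pred[n]⇒suc[m]≤n)
  open import Data.Nat.DivMod using (m/n≡1+[m∸n]/n)
  open import Data.Nat.Combinatorics using (_C_; nCk+nC[k+1]≡[n+1]C[k+1]; nC1≡n)
  open import Data.Nat.Tactic.RingSolver using (solve-∀)

  2*[1+n]C2≡[1+n]*n : ∀ n → 2 * (suc n C 2) ≡ suc n * n
  2*[1+n]C2≡[1+n]*n zero    = refl
  2*[1+n]C2≡[1+n]*n (suc n) = begin
    2 * (suc (suc n) C 2)         ≡⟨ cong (2 *_) (nCk+nC[k+1]≡[n+1]C[k+1] (suc n) 1) ⟨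
    2 * (suc n C 1 + suc n C 2)   ≡⟨ cong (λ c → 2 * (c + suc n C 2)) (nC1≡n (suc n)) ⟩
    2 * (suc n + suc n C 2)       ≡⟨ *-distribˡ-+ 2 (suc n) _ ⟩
    2 * suc n + 2 * (suc n C 2)   ≡⟨ cong (2 * suc n +_) (2*[1+n]C2≡[1+n]*n n) ⟩
    2 * suc n + suc n * n         ≡⟨ 2[1+m]+[1+m]m≡[2+m][1+m] n ⟩
    suc (suc n) * suc n           ∎
    where
    open ≡-Reasoning
    2[1+m]+[1+m]m≡[2+m][1+m] : ∀ m → 2 * suc m + suc m * m ≡ suc (suc m) * suc m
    2[1+m]+[1+m]m≡[2+m][1+m] = solve-∀

  -- t and g are the slacks in r ≤ 2s and r(r − 1) ≤ 2h, and c = d(r − 4) − 2a. Once r + t = 2s and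
  -- r(r − 1) + g = 2h are used, the identity exhibits rhs − lhs as the visibly nonnegative slack.
  cleared-identity : ∀ A D E s h t g →
    let a = suc A; d = 2 + D; e = suc E; r = 1 + a + d + e; q = r * (A + d + e); H = 4 * (h + 1)
        c = D * (1 + A + D + E) + 2 * (D + E)
        lhs = r * d * 4 * h + 2 * (d * (A + d + e) * q + a * H)
        rhs = 2 * (d * (A + d + e) * H + a * q) + r * d * 4 * (a * s + e)
        slack = 2 * (r * A * (r * D + 4 + A + D + E) + r * e * (2 * D + 3) + (7 + 3 * (A + D + E)) * D
                     + 4 * (D + E) + c * g + r * d * a * t)
        P = λ x y → 2 * r * d * a * x + 2 * c * y
    in rhs + P (r + t) (r * (a + d + e) + g) ≡ lhs + slack + P (2 * s) (2 * h)
  cleared-identity = solve-∀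

  cleared-inequality : ∀ {a d e} s h → 1 ≤ a → 2 ≤ d → 1 ≤ e →
    let r = 1 + a + d + e; q = r * (r ∸ 2); H = 4 * (h + 1) in
    r ≤ 2 * s → r C 2 ≤ h →
    r * d * 4 * h + 2 * (d * (r ∸ 2) * q + a * H) ≤ 2 * (d * (r ∸ 2) * H + a * q) + r * d * 4 * (a * s + e)
  cleared-inequality {suc A} {suc (suc D)} {suc E} s h (s≤s z≤n) (s≤s (s≤s z≤n)) (s≤s z≤n) r≤2s rC2≤h
    with t , r+t≡2s ← m≤n⇒∃[o]m+o≡n r≤2s
       | g , r[r-1]+g≡2h ← m≤n⇒∃[o]m+o≡n
           (subst (_≤ 2 * h) (2*[1+n]C2≡[1+n]*n (suc A + (2 + D) + suc E)) (*-monoʳ-≤ 2 rC2≤h))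
    = begin
      lhs           ≤⟨ m≤m+n lhs slack ⟩
      lhs + slack   ≡⟨ +-cancelʳ-≡ _ _ _ identity ⟨
      rhs           ∎
    where
    open ℕ.≤-Reasoning
    a = suc A; d = 2 + D; e = suc E; r = 1 + a + d + e; q = r * (r ∸ 2); H = 4 * (h + 1)
    c = D * (1 + A + D + E) + 2 * (D + E)
    lhs = r * d * 4 * h + 2 * (d * (r ∸ 2) * q + a * H)
    rhs = 2 * (d * (r ∸ 2) * H + a * q) + r * d * 4 * (a * s + e)
    slack = 2 * (r * A * (r * D + 4 + A + D + E) + r * e * (2 * D + 3) + (7 + 3 * (A + D + E)) * D
                 + 4 * (D + E) + c * g + r * d * a * t)
    P : ℕ → ℕ → ℕ
    P x y = 2 * r * d * a * x + 2 * c * y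
    identity : rhs + P (2 * s) (2 * h) ≡ lhs + slack + P (2 * s) (2 * h)
    identity = subst₂ (λ x y → rhs + P x y ≡ lhs + slack + P (2 * s) (2 * h)) r+t≡2s r[r-1]+g≡2h
                      (cleared-identity A D E s h t g)

  ⌈n/2⌉-suc-suc : ∀ n → ⌈ suc (suc n) /2⌉ ≡ suc ⌈ n /2⌉
  ⌈n/2⌉-suc-suc n = m/n≡1+[m∸n]/n {suc (suc (suc n))} (s≤s (s≤s z≤n))

  ⌈n/2⌉-split : ∀ n → ∃[ m ] n ≡ ⌈ n /2⌉ + m × m ≤ ⌈ n /2⌉ × ⌈ n /2⌉ ≤ suc m
  ⌈n/2⌉-split zero       = 0 , refl , z≤n , z≤n
  ⌈n/2⌉-split (suc zero) = 0 , refl , z≤n , s≤s z≤n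
  ⌈n/2⌉-split (suc (suc n)) with m , n≡s+m , m≤s , s≤1+m ← ⌈n/2⌉-split n rewrite ⌈n/2⌉-suc-suc n =
    suc m , cong suc (trans (cong suc n≡s+m) (sym (+-suc ⌈ n /2⌉ m))) , s≤s m≤s , s≤s s≤1+m

  n≤2*⌈n/2⌉ : ∀ n → n ≤ 2 * ⌈ n /2⌉
  n≤2*⌈n/2⌉ n with m , n≡s+m , m≤s , _ ← ⌈n/2⌉-split n =
    subst₂ _≤_ (sym n≡s+m) (cong (⌈ n /2⌉ +_) (sym (+-identityʳ _))) (+-monoʳ-≤ ⌈ n /2⌉ m≤s)

  Admissible : ℕ → ℕ → ℕ → ℕ → Set
  Admissible r s ℓ i = (2 ≤ ℓ × ℓ ≤ s ∸ 2 × r ∸ s + 1 ≤ i × i ≤ r ∸ 1)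
                     ⊎ (ℓ ≡ s ∸ 1 × r ∸ s + 2 ≤ i × i ≤ r ∸ 1)

  split⇒gaps : ∀ {r s m ℓ i} → r ≡ s + m → 3 ≤ s → s ≤ suc m → Admissible r s ℓ i →
               2 ≤ ℓ × 2 + ℓ ≤ i × i < r
  split⇒gaps {s = s} {m} {ℓ} {i} refl 3≤s@(s≤s _) s≤1+m (inj₁ (2≤ℓ , ℓ≤s∸2 , m+1≤i , i≤r∸1)) =
    2≤ℓ , 2+ℓ≤i , m≤pred[n]⇒suc[m]≤n i≤r∸1
    where
    open ℕ.≤-Reasoning
    2+ℓ≤i : 2 + ℓ ≤ i
    2+ℓ≤i = begin
      2 + ℓ           ≡⟨ +-comm 2 ℓ ⟩
      ℓ + 2           ≤⟨ m≤o∸n⇒m+n≤o ℓ (≤-trans (s≤s (s≤s z≤n)) 3≤s) ℓ≤s∸2 ⟩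
      s               ≤⟨ s≤1+m ⟩
      suc m           ≡⟨ +-comm 1 m ⟩
      m + 1           ≡⟨ cong (_+ 1) (m+n∸m≡n s m) ⟨
      s + m ∸ s + 1   ≤⟨ m+1≤i ⟩
      i               ∎
  split⇒gaps {s = s} {m} {ℓ} {i} refl 3≤s@(s≤s _) s≤1+m (inj₂ (refl , m+2≤i , i≤r∸1)) =
    m+n≤o⇒m≤o∸n 2 3≤s , 2+ℓ≤i , m≤pred[n]⇒suc[m]≤n i≤r∸1
    where
    open ℕ.≤-Reasoning
    2+ℓ≤i : 2 + (s ∸ 1) ≤ i
    2+ℓ≤i = begin
      2 + (s ∸ 1)     ≤⟨ +-monoʳ-≤ 2 (m≤n+o⇒m∸n≤o s 1 s≤1+m) ⟩
      2 + m           ≡⟨ +-comm 2 m ⟩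
      m + 2           ≡⟨ cong (_+ 2) (m+n∸m≡n s m) ⟨
      s + m ∸ s + 2   ≤⟨ m+2≤i ⟩
      i               ∎

  admissible⇒gaps : ∀ {r ℓ i} → 5 ≤ r → Admissible r ⌈ r /2⌉ ℓ i → 2 ≤ ℓ × 2 + ℓ ≤ i × i < r
  admissible⇒gaps {r} 5≤r adm with m , r≡s+m , _ , s≤1+m ← ⌈n/2⌉-split r =
    split⇒gaps r≡s+m (*-cancelˡ-< 2 2 ⌈ r /2⌉ (≤-trans 5≤r (n≤2*⌈n/2⌉ r))) s≤1+m adm

  1+[ℓ∸1]+[i∸ℓ]+[r∸i]≡r : ∀ {ℓ i r} → 1 ≤ ℓ → ℓ ≤ i → i ≤ r → 1 + (ℓ ∸ 1) + (i ∸ ℓ) + (r ∸ i) ≡ r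
  1+[ℓ∸1]+[i∸ℓ]+[r∸i]≡r {ℓ} {i} {r} 1≤ℓ ℓ≤i i≤r = begin
    1 + (ℓ ∸ 1) + (i ∸ ℓ) + (r ∸ i)   ≡⟨ cong (λ x → x + (i ∸ ℓ) + (r ∸ i)) (m+[n∸m]≡n 1≤ℓ) ⟩
    ℓ + (i ∸ ℓ) + (r ∸ i)             ≡⟨ cong (_+ (r ∸ i)) (m+[n∸m]≡n ℓ≤i) ⟩
    i + (r ∸ i)                       ≡⟨ m+[n∸m]≡n i≤r ⟩
    r                                 ∎
    where open ≡-Reasoning

open import Data.Nat using () renaming (_+_ to _+ℕ_; _*_ to _*ℕ_)
open import Data.Nat.Combinatorics using (_C_)
open import Data.Nat.Coprimality using (1-coprimeTo) renaming (sym to coprime-sym)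
open import Data.Integer as ℤ using (+_; +≤+)
import Data.Integer.Properties as ℤ
open import Data.Rational as ℚ
  using (ℚ; mkℚ; 0ℚ; 1ℚ; _+_; _-_; _*_; 1/_; _≟_; ≢-nonZero; Positive; *≤*)
  renaming (_≤_ to _≤ℚ_)
open import Data.Rational.Properties as ℚ
  using (normalize-coprime; normalize-pos; +-*-commutativeRing; +-*-ring;
         *-comm; *-assoc; *-inverseˡ; *-identityʳ; *-cancelˡ-≤-pos)
open import Algebra.Properties.Ring +-*-ring using (x[y-z]≈xy-xz)
open import Tactic.RingSolver.Core.AlmostCommutativeRing using (AlmostCommutativeRing; fromCommutativeRing)
open import Tactic.RingSolver using (solve-∀)
open import Relation.Nullary using (yes; no; contradiction; dec⇒maybe)

-- The solver needs a genuine zero test to cancel terms.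
ℚ-ring : AlmostCommutativeRing _ _
ℚ-ring = fromCommutativeRing +-*-commutativeRing (λ x → dec⇒maybe (0ℚ ≟ x))

⟦⟧≡mkℚ : ∀ n → ⟦ n ⟧ ≡ mkℚ (+ n) 0 (coprime-sym (1-coprimeTo n))
⟦⟧≡mkℚ n = normalize-coprime (coprime-sym (1-coprimeTo n))

⟦⟧-homo-+ : ∀ m n → ⟦ m +ℕ n ⟧ ≡ ⟦ m ⟧ + ⟦ n ⟧
⟦⟧-homo-+ m n rewrite ⟦⟧≡mkℚ m | ⟦⟧≡mkℚ n =
  cong (ℚ._/ 1) (trans (ℤ.pos-+ m n) (sym (cong₂ ℤ._+_ (ℤ.*-identityʳ (+ m)) (ℤ.*-identityʳ (+ n)))))

⟦⟧-homo-* : ∀ m n → ⟦ m *ℕ n ⟧ ≡ ⟦ m ⟧ * ⟦ n ⟧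
⟦⟧-homo-* m n rewrite ⟦⟧≡mkℚ m | ⟦⟧≡mkℚ n = cong (ℚ._/ 1) (ℤ.pos-* m n)

⟦⟧-mono-≤ : ∀ {m n} → m ≤ n → ⟦ m ⟧ ≤ℚ ⟦ n ⟧
⟦⟧-mono-≤ {m} {n} m≤n rewrite ⟦⟧≡mkℚ m | ⟦⟧≡mkℚ n =
  *≤* (subst₂ ℤ._≤_ (sym (ℤ.*-identityʳ (+ m))) (sym (ℤ.*-identityʳ (+ n))) (+≤+ m≤n))

⟦⟧-pos : ∀ n .{{_ : NonZero n}} → Positive ⟦ n ⟧
⟦⟧-pos n = normalize-pos n 1

⟦⟧≢0 : ∀ n .{{_ : NonZero n}} → ⟦ n ⟧ ≢ 0ℚ
⟦⟧≢0 n ⟦n⟧≡0 = ≢-nonZero⁻¹ n (ℤ.+-injective (cong ℚ.↥_ (trans (sym (⟦⟧≡mkℚ n)) ⟦n⟧≡0)))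

*-⊘-cancel : ∀ p q → q ≢ 0ℚ → q * (p ⊘ q) ≡ p
*-⊘-cancel p q q≢0 with q ≟ 0ℚ
... | yes q≡0 = contradiction q≡0 q≢0
... | no _ = begin
  q * (p * 1/ q)   ≡⟨ *-comm q _ ⟩
  p * 1/ q * q     ≡⟨ *-assoc p (1/ q) q ⟩
  p * (1/ q * q)   ≡⟨ cong (p *_) (*-inverseˡ q) ⟩
  p * 1ℚ           ≡⟨ *-identityʳ p ⟩
  p                ∎
  where
  open ≡-Reasoning
  instance _ = ≢-nonZero q≢0

⟦⟧-*-distribˡ-− : ∀ k x y → ⟦ k ⟧ * (⟦ x ⟧ - ⟦ y ⟧) ≡ ⟦ k *ℕ x ⟧ - ⟦ k *ℕ y ⟧
⟦⟧-*-distribˡ-− k x y =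
  trans (x[y-z]≈xy-xz ⟦ k ⟧ ⟦ x ⟧ ⟦ y ⟧) (sym (cong₂ _-_ (⟦⟧-homo-* k x) (⟦⟧-homo-* k y)))

⟦⟧-*-[−⊘] : ∀ n x y .{{_ : NonZero n}} → ⟦ n ⟧ * (⟦ x ⟧ - ⟦ y ⟧ ⊘ ⟦ n ⟧) ≡ ⟦ n *ℕ x ⟧ - ⟦ y ⟧
⟦⟧-*-[−⊘] n x y = trans (x[y-z]≈xy-xz ⟦ n ⟧ ⟦ x ⟧ (⟦ y ⟧ ⊘ ⟦ n ⟧))
  (cong₂ _-_ (sym (⟦⟧-homo-* n x)) (*-⊘-cancel ⟦ y ⟧ ⟦ n ⟧ (⟦⟧≢0 n)))

[⟦⟧−⟦⟧]*[⟦⟧−⟦⟧] : ∀ x y z w →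
  (⟦ x ⟧ - ⟦ y ⟧) * (⟦ z ⟧ - ⟦ w ⟧) ≡ ⟦ x *ℕ z +ℕ y *ℕ w ⟧ - ⟦ x *ℕ w +ℕ y *ℕ z ⟧
[⟦⟧−⟦⟧]*[⟦⟧−⟦⟧] x y z w = begin
  (⟦ x ⟧ - ⟦ y ⟧) * (⟦ z ⟧ - ⟦ w ⟧)                       ≡⟨ expand ⟦ x ⟧ ⟦ y ⟧ ⟦ z ⟧ ⟦ w ⟧ ⟩
  (⟦ x ⟧ * ⟦ z ⟧ + ⟦ y ⟧ * ⟦ w ⟧) - (⟦ x ⟧ * ⟦ w ⟧ + ⟦ y ⟧ * ⟦ z ⟧) ≡⟨ cong₂ _-_ (homo x z y w) (homo x w y z) ⟨
  ⟦ x *ℕ z +ℕ y *ℕ w ⟧ - ⟦ x *ℕ w +ℕ y *ℕ z ⟧           ∎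
  where
  open ≡-Reasoning
  expand : ∀ p q r s → (p - q) * (r - s) ≡ (p * r + q * s) - (p * s + q * r)
  expand = solve-∀ ℚ-ring
  homo : ∀ m n o p → ⟦ m *ℕ n +ℕ o *ℕ p ⟧ ≡ ⟦ m ⟧ * ⟦ n ⟧ + ⟦ o ⟧ * ⟦ p ⟧
  homo m n o p = trans (⟦⟧-homo-+ (m *ℕ n) (o *ℕ p)) (cong₂ _+_ (⟦⟧-homo-* m n) (⟦⟧-homo-* o p))

⟦⟧−⟦⟧-mono-≤ : ∀ {x y z w} → x +ℕ w ≤ z +ℕ y → ⟦ x ⟧ - ⟦ y ⟧ ≤ℚ ⟦ z ⟧ - ⟦ w ⟧
⟦⟧−⟦⟧-mono-≤ {x} {y} {z} {w} x+w≤z+y = begin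
  ⟦ x ⟧ - ⟦ y ⟧                          ≡⟨ shift ⟦ x ⟧ ⟦ y ⟧ ⟦ w ⟧ ⟩
  (⟦ x ⟧ + ⟦ w ⟧) - (⟦ y ⟧ + ⟦ w ⟧)      ≤⟨ ℚ.+-monoˡ-≤ (ℚ.- (⟦ y ⟧ + ⟦ w ⟧)) ⟦x⟧+⟦w⟧≤⟦z⟧+⟦y⟧ ⟩
  (⟦ z ⟧ + ⟦ y ⟧) - (⟦ y ⟧ + ⟦ w ⟧)      ≡⟨ cancel ⟦ z ⟧ ⟦ y ⟧ ⟦ w ⟧ ⟩
  ⟦ z ⟧ - ⟦ w ⟧                          ∎
  where
  open ℚ.≤-Reasoning
  ⟦x⟧+⟦w⟧≤⟦z⟧+⟦y⟧ : ⟦ x ⟧ + ⟦ w ⟧ ≤ℚ ⟦ z ⟧ + ⟦ y ⟧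
  ⟦x⟧+⟦w⟧≤⟦z⟧+⟦y⟧ = subst₂ _≤ℚ_ (⟦⟧-homo-+ x w) (⟦⟧-homo-+ z y) (⟦⟧-mono-≤ x+w≤z+y)
  shift : ∀ p q r → p - q ≡ (p + r) - (q + r)
  shift = solve-∀ ℚ-ring
  cancel : ∀ p q r → (p + q) - (q + r) ≡ p - r
  cancel = solve-∀ ℚ-ring

inequality-in-gaps : ∀ {r a d e} s h → 1 +ℕ a +ℕ d +ℕ e ≡ r → 1 ≤ a → 2 ≤ d → 1 ≤ e →
  r ≤ 2 *ℕ s → r C 2 ≤ h →
  ⟦ h ⟧ - (⟦ a ⟧ * ⟦ s ⟧ + ⟦ e ⟧)
    ≤ℚ (⟦ 2 ⟧ ⊘ ⟦ r ⟧) * (⟦ r ∸ 2 ⟧ - ⟦ a ⟧ ⊘ ⟦ d ⟧) * (⟦ h ⟧ - ⟦ r *ℕ (r ∸ 2) ⟧ ⊘ ⟦ 4 ⟧ + ⟦ 1 ⟧)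
inequality-in-gaps {a = a} {d} {e} s h refl 1≤a@(s≤s _) 2≤d@(s≤s (s≤s _)) 1≤e r≤2s C≤h =
  *-cancelˡ-≤-pos ⟦ K ⟧ {{⟦⟧-pos K}} (begin
    ⟦ K ⟧ * (⟦ h ⟧ - (⟦ a ⟧ * ⟦ s ⟧ + ⟦ e ⟧))  ≡⟨ cong (λ x → ⟦ K ⟧ * (⟦ h ⟧ - x)) ⟦as+e⟧≡ ⟨
    ⟦ K ⟧ * (⟦ h ⟧ - ⟦ a *ℕ s +ℕ e ⟧)         ≡⟨ ⟦⟧-*-distribˡ-− K h (a *ℕ s +ℕ e) ⟩
    ⟦ K *ℕ h ⟧ - ⟦ K *ℕ (a *ℕ s +ℕ e) ⟧       ≤⟨ ⟦⟧−⟦⟧-mono-≤ {K *ℕ h} {K *ℕ (a *ℕ s +ℕ e)} {P} {N} (cleared-inequality s h 1≤a 2≤d 1≤e r≤2s C≤h) ⟩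
    ⟦ P ⟧ - ⟦ N ⟧                             ≡⟨ K*rhs ⟨
    ⟦ K ⟧ * (u * V * W)                        ∎)
  where
  open ℚ.≤-Reasoning
  r = 1 +ℕ a +ℕ d +ℕ e
  K = r *ℕ d *ℕ 4
  q = r *ℕ (r ∸ 2)
  dR = d *ℕ (r ∸ 2)
  H = 4 *ℕ (h +ℕ 1)
  P = 2 *ℕ (dR *ℕ H +ℕ a *ℕ q)
  N = 2 *ℕ (dR *ℕ q +ℕ a *ℕ H)
  u = ⟦ 2 ⟧ ⊘ ⟦ r ⟧
  V = ⟦ r ∸ 2 ⟧ - ⟦ a ⟧ ⊘ ⟦ d ⟧
  W = ⟦ h ⟧ - ⟦ q ⟧ ⊘ ⟦ 4 ⟧ + ⟦ 1 ⟧
  ⟦as+e⟧≡ : ⟦ a *ℕ s +ℕ e ⟧ ≡ ⟦ a ⟧ * ⟦ s ⟧ + ⟦ e ⟧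
  ⟦as+e⟧≡ = trans (⟦⟧-homo-+ (a *ℕ s) e) (cong (_+ ⟦ e ⟧) (⟦⟧-homo-* a s))
  regroup : ∀ x y z u v w → x * y * z * (u * v * w) ≡ (x * u) * (y * v) * (z * w)
  regroup = solve-∀ ℚ-ring
  x-y+z≡x+z-y : ∀ x y z → x - y + z ≡ x + z - y
  x-y+z≡x+z-y = solve-∀ ℚ-ring
  W≡ : W ≡ ⟦ h +ℕ 1 ⟧ - ⟦ q ⟧ ⊘ ⟦ 4 ⟧
  W≡ = trans (x-y+z≡x+z-y ⟦ h ⟧ (⟦ q ⟧ ⊘ ⟦ 4 ⟧) ⟦ 1 ⟧) (cong (_- ⟦ q ⟧ ⊘ ⟦ 4 ⟧) (sym (⟦⟧-homo-+ h 1)))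
  K*rhs : ⟦ K ⟧ * (u * V * W) ≡ ⟦ P ⟧ - ⟦ N ⟧
  K*rhs = begin-equality
    ⟦ K ⟧ * (u * V * W)
      ≡⟨ cong (_* (u * V * W)) (trans (⟦⟧-homo-* (r *ℕ d) 4) (cong (_* ⟦ 4 ⟧) (⟦⟧-homo-* r d))) ⟩
    ⟦ r ⟧ * ⟦ d ⟧ * ⟦ 4 ⟧ * (u * V * W)
      ≡⟨ regroup ⟦ r ⟧ ⟦ d ⟧ ⟦ 4 ⟧ u V W ⟩
    (⟦ r ⟧ * u) * (⟦ d ⟧ * V) * (⟦ 4 ⟧ * W)
      ≡⟨ cong₂ _*_ (cong₂ _*_ (*-⊘-cancel ⟦ 2 ⟧ ⟦ r ⟧ (⟦⟧≢0 r)) (⟦⟧-*-[−⊘] d (r ∸ 2) a))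
                   (trans (cong (⟦ 4 ⟧ *_) W≡) (⟦⟧-*-[−⊘] 4 (h +ℕ 1) q)) ⟩
    ⟦ 2 ⟧ * (⟦ dR ⟧ - ⟦ a ⟧) * (⟦ H ⟧ - ⟦ q ⟧)
      ≡⟨ *-assoc ⟦ 2 ⟧ (⟦ dR ⟧ - ⟦ a ⟧) (⟦ H ⟧ - ⟦ q ⟧) ⟩
    ⟦ 2 ⟧ * ((⟦ dR ⟧ - ⟦ a ⟧) * (⟦ H ⟧ - ⟦ q ⟧))
      ≡⟨ cong (⟦ 2 ⟧ *_) ([⟦⟧−⟦⟧]*[⟦⟧−⟦⟧] dR a H q) ⟩
    ⟦ 2 ⟧ * (⟦ dR *ℕ H +ℕ a *ℕ q ⟧ - ⟦ dR *ℕ q +ℕ a *ℕ H ⟧)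
      ≡⟨ ⟦⟧-*-distribˡ-− 2 (dR *ℕ H +ℕ a *ℕ q) (dR *ℕ q +ℕ a *ℕ H) ⟩
    ⟦ P ⟧ - ⟦ N ⟧ ∎

lemma2p1 : (r h ℓ i : ℕ) → 5 ≤ r → r C 2 ≤ h →
    ((2 ≤ ℓ × ℓ ≤ ⌈ r /2⌉ ∸ 2 × r ∸ ⌈ r /2⌉ +ℕ 1 ≤ i × i ≤ r ∸ 1)
      ⊎ (ℓ ≡ ⌈ r /2⌉ ∸ 1 × r ∸ ⌈ r /2⌉ +ℕ 2 ≤ i × i ≤ r ∸ 1)) →
    ⟦ h ⟧ - (⟦ ℓ ∸ 1 ⟧ * ⟦ ⌈ r /2⌉ ⟧ + ⟦ r ∸ i ⟧)
      ≤ℚ (⟦ 2 ⟧ ⊘ ⟦ r ⟧) * (⟦ r ∸ 2 ⟧ - ⟦ ℓ ∸ 1 ⟧ ⊘ ⟦ i ∸ ℓ ⟧)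
          * (⟦ h ⟧ - ⟦ r *ℕ (r ∸ 2) ⟧ ⊘ ⟦ 4 ⟧ + ⟦ 1 ⟧)
lemma2p1 r h ℓ i 5≤r C≤h adm with 2≤ℓ , 2+ℓ≤i , i<r ← admissible⇒gaps 5≤r adm =
  inequality-in-gaps ⌈ r /2⌉ h
    (1+[ℓ∸1]+[i∸ℓ]+[r∸i]≡r (ℕ.≤-trans (s≤s z≤n) 2≤ℓ) (ℕ.m+n≤o⇒n≤o 2 2+ℓ≤i) (ℕ.<⇒≤ i<r))
    (ℕ.m+n≤o⇒m≤o∸n 1 2≤ℓ) (ℕ.m+n≤o⇒m≤o∸n 2 2+ℓ≤i) (ℕ.m<n⇒0<n∸m i<r)
    (n≤2*⌈n/2⌉ r) C≤h
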